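{- Let $n\ge 6$ be an integer and $N=T_n=n(n+1)/2$. Then: (1) if $n$ is even, the only maximal unrefinable partition of $N$ is $\widetilde{\pi_n}=(1,2,\dots,n-3,n+1,2n-4)$; (2) if $n$ is odd, then $\widetilde{\pi_n}$ is a maximal unrefinable partition of $N$, and every maximal unrefinable partition $\lambda\neq\widetilde{\pi_n}$ of $N$ satisfies $j=h-2$ together with: (i) for each $1\le i\le h-3$, the integer $2n-4-a_i$ is a part of $\lambda$ (these are the replacements of $a_1,\dots,a_{h-3}$); and (ii) the triple $(a_{h-2},a_{h-1},a_h)$ is one of $(n-4,n-3,n-2)$, $(n-4,n-2,n-1)$, $(n-3,n-2,n)$, $(n-2,n-1,n)$.
   Context: A partition of $N$ into distinct parts is a sequence of positive integers $\lambda_1<\dots<\lambda_t$ with $t\ge2$ summing to $N$; $\lambda_t$ is its maximal part. Missing parts are the elements of $\{1,\dots,\lambda_t\}\setminus\{\lambda_1,\dots,\lambda_t\}$. The partition is refinable if some part equals the sum of two distinct missing parts, and unrefinable otherwise. An unrefinable partition of $N$ is maximal if its maximal part is the largest maximal part among all unrefinable partitions of $N$. For an unrefinable partition $\lambda$ of $T_n$, let $a_1<a_2<\dots<a_h$ be the elements of $\{1,\dots,n\}$ that are not parts of $\lambda$ (the "removed parts") and let $j$ be the number of parts of $\lambda$ that are larger than $n$ (the "replacements"). -}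

module Defs where

open import Data.Nat using (ℕ; zero; suc; _+_; _*_; _∸_; _≤_; _<_; _<?_; _⊔_)
open import Data.Nat.Properties using (_≟_)
open import Data.Nat.DivMod using (_/_)
open import Data.List using (List; []; _∷_; _++_; length; map; upTo; filter; foldr)
open import Data.Nat.ListAction using (sum)
open import Data.List.Relation.Unary.All using (All)
open import Data.List.Relation.Unary.Linked using (Linked)
open import Data.List.Membership.Propositional using (_∈_; _∉_)
open import Data.List.Membership.DecPropositional _≟_ using (_∈?_)
open import Data.Product using (Σ; ∃; _×_; _,_)
open import Data.Sum using (_⊎_)
open import Relation.Nullary using (¬_)
open import Relation.Nullary.Decidable using (¬?)
open import Relation.Binary.PropositionalEquality using (_≡_; _≢_)

T : ℕ → ℕ
T n = (n * suc n) / 2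

record IsDistinctPartition (N : ℕ) (λs : List ℕ) : Set where
  field
    increasing : Linked _<_ λs
    positive   : All (0 <_) λs
    atLeastTwo : 2 ≤ length λs
    sumIsN     : sum λs ≡ N

maxPart : List ℕ → ℕ
maxPart = foldr _⊔_ 0

Missing : List ℕ → ℕ → Set
Missing λs m = (1 ≤ m) × (m ≤ maxPart λs) × (m ∉ λs)

Refinable : List ℕ → Set
Refinable λs = Σ ℕ λ p → Σ ℕ λ x → Σ ℕ λ y →
  (p ∈ λs) × Missing λs x × Missing λs y × (x ≢ y) × (p ≡ x + y)

Unrefinable : List ℕ → Set
Unrefinable λs = ¬ Refinable λs

IsUnrefinablePartition : ℕ → List ℕ → Set
IsUnrefinablePartition N λs = IsDistinctPartition N λs × Unrefinable λs

IsMaximalUnrefinable : ℕ → List ℕ → Set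
IsMaximalUnrefinable N λs =
  IsUnrefinablePartition N λs ×
  ((μ : List ℕ) → IsUnrefinablePartition N μ → maxPart μ ≤ maxPart λs)

oneTo : ℕ → List ℕ
oneTo k = map suc (upTo k)

piTilde : ℕ → List ℕ
piTilde n = oneTo (n ∸ 3) ++ (suc n ∷ (2 * n ∸ 4) ∷ [])

-- removed parts a₁ < … < a_h : elements of {1,…,n} that are not parts of λ
removed : ℕ → List ℕ → List ℕ
removed n λs = filter (λ a → ¬? (a ∈? λs)) (oneTo n)

-- j : number of parts of λ larger than n
replacements : ℕ → List ℕ → ℕ
replacements n λs = length (filter (n <?_) λs)

-- Write the maximal part of an unrefinable partition λ as M = 2k + r + 1 with r ≤ 1.  Each pair
-- {k − i, k + r + 1 + i}, i < k, sums to the part M, so λ contains a member of every pair; hence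
-- the parts sum to T_k + M, plus k + 1 if r = 1 and it is a part, plus the excess of each pair
-- over its smaller member: 0 or 2i + 1 + r when λ contains one member, k + r + 1 + i when both.
-- Comparing with T_n forces M ≤ 2n − 4.  For M = 2n − 4 (k = n − 3, r = 1) the excesses add up
-- to n + 1.  A pair with both members contributes at least n − 1 and the other pairs even
-- amounts, so either exactly the pair {n − 5, n + 1} has both members and λ = π̃_n, or every pair
-- has exactly one, n + 1 is even, and each removed part a ≤ n − 5 is replaced by 2n − 4 − a.

module Submission where

open import Function using (_∘_)
open import Data.Empty using (⊥-elim)
open import Data.Product using (Σ; ∃; _×_; _,_; proj₁; proj₂)
open import Data.Sum using (_⊎_; inj₁; inj₂)
open import Relation.Nullary using (¬_; Dec; yes; no)
open import Relation.Nullary.Decidable using (_×-dec_; ¬?)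
open import Relation.Unary using (Decidable)
open import Relation.Binary.PropositionalEquality
  using (_≡_; _≢_; refl; sym; trans; cong; cong₂; subst; module ≡-Reasoning)
open import Data.Nat using (ℕ; zero; suc; _+_; _*_; _∸_; _≤_; _<_; _≤?_; _<?_; z≤n; s≤s)
open import Data.Nat.Properties
open import Data.Nat.Divisibility using (_∣_; divides; ∣m∣n⇒∣m+n; ∣m+n∣m⇒∣n; ∣1⇒≡1)
open import Data.Nat.DivMod using (_/_; m*n/n≡m)
open import Data.Nat.ListAction using (sum)
open import Data.Nat.ListAction.Properties using (sum-++)
open import Data.Nat.Tactic.RingSolver using (solve-∀)
open import Data.List using (List; []; _∷_; _++_; length; map; filter; applyUpTo; upTo)
open import Data.List.Properties
  using (map-id; map-upTo; map-applyUpTo; length-++; length-++-≤ʳ; filter-++; filter-accept; filter-reject)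
open import Data.List.Membership.Propositional using (_∈_; _∉_)
open import Data.List.Membership.Propositional.Properties using (∈-++⁺ˡ; ∈-++⁺ʳ; ∈-++⁻; ∈-filter⁻)
open import Data.List.Membership.DecPropositional _≟_ using (_∈?_)
open import Data.List.Relation.Unary.All using (All; []; _∷_)
import Data.List.Relation.Unary.All as All
import Data.List.Relation.Unary.All.Properties as All
open import Data.List.Relation.Unary.Any using (here; there)
import Data.List.Relation.Unary.Any.Properties as Any
open import Data.List.Relation.Unary.AllPairs using ([]; _∷_)
import Data.List.Relation.Unary.AllPairs.Properties as AllPairs
open import Data.List.Relation.Unary.Linked using (Linked)
import Data.List.Relation.Unary.Linked as Linked
open import Data.List.Relation.Unary.Linked.Properties using (Linked⇒AllPairs; AllPairs⇒Linked)

open import Defs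

∑ : ℕ → (ℕ → ℕ) → ℕ
∑ zero    g = 0
∑ (suc k) g = g 0 + ∑ k (g ∘ suc)
syntax ∑ k (λ i → t) = ∑[ i < k ] t

∑-cong : ∀ k {g h : ℕ → ℕ} → (∀ i → i < k → g i ≡ h i) → ∑ k g ≡ ∑ k h
∑-cong zero    eq = refl
∑-cong (suc k) eq = cong₂ _+_ (eq 0 (s≤s z≤n)) (∑-cong k (λ i i<k → eq (suc i) (s≤s i<k)))

∑-distrib-+ : ∀ k (g h : ℕ → ℕ) → ∑[ i < k ] (g i + h i) ≡ ∑ k g + ∑ k h
∑-distrib-+ zero    g h = refl
∑-distrib-+ (suc k) g h = begin
  g 0 + h 0 + ∑[ i < k ] (g (suc i) + h (suc i))  ≡⟨ cong (g 0 + h 0 +_) (∑-distrib-+ k (g ∘ suc) (h ∘ suc)) ⟩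
  g 0 + h 0 + (∑ k (g ∘ suc) + ∑ k (h ∘ suc))     ≡⟨ +-assoc-comm (g 0) (h 0) _ _ ⟩
  g 0 + ∑ k (g ∘ suc) + (h 0 + ∑ k (h ∘ suc))     ∎
  where
  open ≡-Reasoning
  +-assoc-comm : ∀ a b c d → a + b + (c + d) ≡ a + c + (b + d)
  +-assoc-comm = solve-∀

∑-split : ∀ a b (g : ℕ → ℕ) → ∑ (a + b) g ≡ ∑ a g + ∑[ i < b ] g (a + i)
∑-split zero    b g = refl
∑-split (suc a) b g = trans (cong (g 0 +_) (∑-split a b (g ∘ suc))) (sym (+-assoc (g 0) _ _))

∑-snoc : ∀ k (g : ℕ → ℕ) → ∑ (suc k) g ≡ ∑ k g + g k
∑-snoc k g = begin
  ∑ (suc k) g                    ≡⟨ cong (λ l → ∑ l g) (+-comm 1 k) ⟩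
  ∑ (k + 1) g                    ≡⟨ ∑-split k 1 g ⟩
  ∑ k g + (g (k + 0) + 0)        ≡⟨ cong (λ x → ∑ k g + x) (trans (+-identityʳ _) (cong g (+-identityʳ k))) ⟩
  ∑ k g + g k                    ∎
  where open ≡-Reasoning

∑-reverse : ∀ k (g : ℕ → ℕ) → ∑ k g ≡ ∑[ i < k ] g (k ∸ suc i)
∑-reverse zero    g = refl
∑-reverse (suc k) g = begin
  g 0 + ∑ k (g ∘ suc)                          ≡⟨ cong (g 0 +_) (∑-reverse k (g ∘ suc)) ⟩
  g 0 + ∑[ i < k ] g (suc (k ∸ suc i))          ≡⟨ +-comm (g 0) _ ⟩
  ∑[ i < k ] g (suc (k ∸ suc i)) + g 0          ≡⟨ cong₂ _+_ (∑-cong k (λ i i<k → cong g (sym (+-∸-assoc 1 i<k))))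
                                                             (cong g (sym (n∸n≡0 k))) ⟩
  ∑[ i < k ] g (k ∸ i) + g (k ∸ k)              ≡⟨ sym (∑-snoc k (λ i → g (k ∸ i))) ⟩
  ∑[ i < suc k ] g (suc k ∸ suc i)              ∎
  where open ≡-Reasoning

∑-zero : ∀ k (g : ℕ → ℕ) → (∀ i → i < k → g i ≡ 0) → ∑ k g ≡ 0
∑-zero zero    g z = refl
∑-zero (suc k) g z = cong₂ _+_ (z 0 (s≤s z≤n)) (∑-zero k (g ∘ suc) (λ i i<k → z (suc i) (s≤s i<k)))

∑-single : ∀ k (g : ℕ → ℕ) j → j < k → (∀ i → i < k → i ≢ j → g i ≡ 0) → ∑ k g ≡ g j
∑-single (suc k) g zero    _         z =
  trans (cong (g 0 +_) (∑-zero k (g ∘ suc) (λ i i<k → z (suc i) (s≤s i<k) (λ ())))) (+-identityʳ _)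
∑-single (suc k) g (suc j) (s≤s j<k) z =
  cong₂ _+_ (z 0 (s≤s z≤n) (λ ()))
            (∑-single k (g ∘ suc) j j<k (λ i i<k i≢j → z (suc i) (s≤s i<k) (i≢j ∘ suc-injective)))

term≤∑ : ∀ k (g : ℕ → ℕ) j → j < k → g j ≤ ∑ k g
term≤∑ (suc k) g zero    _         = m≤m+n (g 0) _
term≤∑ (suc k) g (suc j) (s≤s j<k) = ≤-trans (term≤∑ k (g ∘ suc) j j<k) (m≤n+m _ (g 0))

twoTerms≤∑ : ∀ k (g : ℕ → ℕ) i j → i < k → j < k → i ≢ j → g i + g j ≤ ∑ k g
twoTerms≤∑ (suc k) g zero    zero    _         _         i≢j = ⊥-elim (i≢j refl)
twoTerms≤∑ (suc k) g zero    (suc j) _         (s≤s j<k) _   = +-monoʳ-≤ (g 0) (term≤∑ k (g ∘ suc) j j<k)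
twoTerms≤∑ (suc k) g (suc i) zero    (s≤s i<k) _         _   =
  subst (_≤ g 0 + ∑ k (g ∘ suc)) (+-comm (g 0) (g (suc i))) (+-monoʳ-≤ (g 0) (term≤∑ k (g ∘ suc) i i<k))
twoTerms≤∑ (suc k) g (suc i) (suc j) (s≤s i<k) (s≤s j<k) i≢j =
  ≤-trans (twoTerms≤∑ k (g ∘ suc) i j i<k j<k (i≢j ∘ cong suc)) (m≤n+m _ (g 0))

∑-divisible : ∀ {d} k (g : ℕ → ℕ) → (∀ i → i < k → d ∣ g i) → d ∣ ∑ k g
∑-divisible zero    g dvd = divides 0 refl
∑-divisible (suc k) g dvd =
  ∣m∣n⇒∣m+n (dvd 0 (s≤s z≤n)) (∑-divisible k (g ∘ suc) (λ i i<k → dvd (suc i) (s≤s i<k)))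

tri : ℕ → ℕ
tri zero    = 0
tri (suc n) = suc n + tri n

∑-downFrom≡tri : ∀ k → ∑[ i < k ] (k ∸ i) ≡ tri k
∑-downFrom≡tri zero    = refl
∑-downFrom≡tri (suc k) = cong (suc k +_) (∑-downFrom≡tri k)

∑-upTo≡tri : ∀ k → ∑ k suc ≡ tri k
∑-upTo≡tri k = begin
  ∑ k suc                       ≡⟨ ∑-reverse k suc ⟩
  ∑[ i < k ] suc (k ∸ suc i)    ≡⟨ ∑-cong k (λ i i<k → sym (+-∸-assoc 1 i<k)) ⟩
  ∑[ i < k ] (k ∸ i)            ≡⟨ ∑-downFrom≡tri k ⟩
  tri k                         ∎
  where open ≡-Reasoning

tri-mono-≤ : ∀ {a b} → a ≤ b → tri a ≤ tri b
tri-mono-≤ {zero}  {b}     _         = z≤n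
tri-mono-≤ {suc a} {suc b} (s≤s a≤b) = +-mono-≤ (s≤s a≤b) (tri-mono-≤ a≤b)

T≡tri : ∀ n → T n ≡ tri n
T≡tri n = trans (cong (_/ 2) (twice-tri n)) (m*n/n≡m (tri n) 2)
  where
  twice-tri : ∀ n → n * suc n ≡ tri n * 2
  twice-tri zero    = refl
  twice-tri (suc n) = begin
    suc n * suc (suc n)         ≡⟨ expand n ⟩
    suc n * 2 + n * suc n       ≡⟨ cong (suc n * 2 +_) (twice-tri n) ⟩
    suc n * 2 + tri n * 2       ≡⟨ sym (*-distribʳ-+ 2 (suc n) (tri n)) ⟩
    (suc n + tri n) * 2         ∎
    where
    open ≡-Reasoning
    expand : ∀ n → suc n * suc (suc n) ≡ suc n * 2 + n * suc n
    expand = solve-∀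

split-half : ∀ n → ∃ λ k → ∃ λ r → r ≤ 1 × n ≡ k + r + k
split-half zero          = 0 , 0 , z≤n , refl
split-half (suc zero)    = 0 , 1 , s≤s z≤n , refl
split-half (suc (suc n)) with split-half n
... | k , r , r≤1 , refl = suc k , r , r≤1 , cong suc (sym (+-suc (k + r) k))

distinct-lowerBound-+ : ∀ {a x y} → a ≤ x → a ≤ y → x ≢ y → suc (a + a) ≤ x + y
distinct-lowerBound-+ {a} {x} {y} a≤x a≤y x≢y with m≤n⇒m<n∨m≡n a≤x
... | inj₁ a<x  = +-mono-≤ a<x a≤y
... | inj₂ refl with m≤n⇒m<n∨m≡n a≤y
...   | inj₁ a<y  = subst (_≤ a + y) (+-suc a a) (+-monoʳ-≤ a a<y)
...   | inj₂ refl = ⊥-elim (x≢y refl)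

2∣n⇒2∤1+n : ∀ {n} → 2 ∣ n → ¬ 2 ∣ suc n
2∣n⇒2∤1+n {n} 2∣n 2∣1+n with () ← ∣1⇒≡1 (∣m+n∣m⇒∣n (subst (2 ∣_) (+-comm 1 n) 2∣1+n) 2∣n)

Linked<⇒head< : ∀ {x xs} → Linked _<_ (x ∷ xs) → All (x <_) xs
Linked<⇒head< l with Linked⇒AllPairs <-trans l
... | x<xs ∷ _ = x<xs

Linked<⇒head∉ : ∀ {x xs} → Linked _<_ (x ∷ xs) → x ∉ xs
Linked<⇒head∉ l x∈xs = <-irrefl refl (All.lookup (Linked<⇒head< l) x∈xs)

Linked<-≡ : ∀ xs ys → Linked _<_ xs → Linked _<_ ys →
  (∀ {z} → z ∈ xs → z ∈ ys) → (∀ {z} → z ∈ ys → z ∈ xs) → xs ≡ ys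
Linked<-≡ [] [] _ _ _ _ = refl
Linked<-≡ [] (y ∷ ys) _ _ _ ys⊆xs with () ← ys⊆xs (here refl)
Linked<-≡ (x ∷ xs) [] _ _ xs⊆ys _ with () ← xs⊆ys (here refl)
Linked<-≡ (x ∷ xs) (y ∷ ys) lx ly xs⊆ys ys⊆xs =
  cong₂ _∷_ x≡y (Linked<-≡ xs ys (Linked.tail lx) (Linked.tail ly) tail⊆ tail⊇)
  where
  x≡y : x ≡ y
  x≡y with xs⊆ys (here refl) | ys⊆xs (here refl)
  ... | here eq     | _           = eq
  ... | there _     | here eq     = sym eq
  ... | there x∈ys  | there y∈xs  =
    ⊥-elim (<-asym (All.lookup (Linked<⇒head< ly) x∈ys) (All.lookup (Linked<⇒head< lx) y∈xs))
  tail⊆ : ∀ {z} → z ∈ xs → z ∈ ys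
  tail⊆ z∈xs with xs⊆ys (there z∈xs)
  ... | here refl = ⊥-elim (<-irrefl x≡y (All.lookup (Linked<⇒head< lx) z∈xs))
  ... | there z∈ys = z∈ys
  tail⊇ : ∀ {z} → z ∈ ys → z ∈ xs
  tail⊇ z∈ys with ys⊆xs (there z∈ys)
  ... | here refl = ⊥-elim (<-irrefl (sym x≡y) (All.lookup (Linked<⇒head< ly) z∈ys))
  ... | there z∈xs = z∈xs

≤-maxPart : ∀ {x} L → x ∈ L → x ≤ maxPart L
≤-maxPart (y ∷ L) (here refl) = m≤m⊔n y (maxPart L)
≤-maxPart (y ∷ L) (there x∈L) = ≤-trans (≤-maxPart L x∈L) (m≤n⊔m y (maxPart L))

maxPart-∈ : ∀ x L → maxPart (x ∷ L) ∈ x ∷ L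
maxPart-∈ x [] = here (⊔-identityʳ x)
maxPart-∈ x (y ∷ L) with ⊔-sel x (maxPart (y ∷ L))
... | inj₁ eq = here eq
... | inj₂ eq = there (subst (_∈ y ∷ L) (sym eq) (maxPart-∈ y L))

maxPart-∈-nonzero : ∀ L → 0 < maxPart L → maxPart L ∈ L
maxPart-∈-nonzero (x ∷ L) _ = maxPart-∈ x L

maxPart-≤ : ∀ {B} L → All (_≤ B) L → maxPart L ≤ B
maxPart-≤ [] _ = z≤n
maxPart-≤ (x ∷ L) (x≤B ∷ L≤B) = ⊔-lub x≤B (maxPart-≤ L L≤B)

applyUpTo-cong : ∀ {A : Set} n {f g : ℕ → A} → (∀ i → f i ≡ g i) → applyUpTo f n ≡ applyUpTo g n
applyUpTo-cong zero    f≗g = refl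
applyUpTo-cong (suc n) f≗g = cong₂ _∷_ (f≗g 0) (applyUpTo-cong n (f≗g ∘ suc))

applyUpTo-++ : ∀ {A : Set} (f : ℕ → A) a b → applyUpTo f (a + b) ≡ applyUpTo f a ++ applyUpTo (f ∘ (a +_)) b
applyUpTo-++ f zero    b = refl
applyUpTo-++ f (suc a) b = cong (f 0 ∷_) (applyUpTo-++ (f ∘ suc) a b)

sum-applyUpTo : ∀ (f : ℕ → ℕ) k → sum (applyUpTo f k) ≡ ∑ k f
sum-applyUpTo f zero    = refl
sum-applyUpTo f (suc k) = cong (f 0 +_) (sum-applyUpTo (f ∘ suc) k)

indicator : {A : Set} → Dec A → ℕ → ℕ
indicator (yes _) v = v
indicator (no _)  v = 0

indicator-yes : {A : Set} (d : Dec A) {v : ℕ} → A → indicator d v ≡ v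
indicator-yes (yes _) a = refl
indicator-yes (no ¬a) a = ⊥-elim (¬a a)

indicator-no : {A : Set} (d : Dec A) {v : ℕ} → ¬ A → indicator d v ≡ 0
indicator-no (yes a) ¬a = ⊥-elim (¬a a)
indicator-no (no _)  ¬a = refl

indicator-zero⊎id : {A : Set} (d : Dec A) (v : ℕ) → indicator d v ≡ 0 ⊎ indicator d v ≡ v
indicator-zero⊎id (yes _) v = inj₂ refl
indicator-zero⊎id (no _)  v = inj₁ refl

indicator-zero : {A : Set} (d : Dec A) → indicator d 0 ≡ 0
indicator-zero (yes _) = refl
indicator-zero (no _)  = refl

indicator-cong : {A B : Set} (dA : Dec A) (dB : Dec B) {v : ℕ} →
                 (A → B) → (B → A) → indicator dA v ≡ indicator dB v
indicator-cong (yes a) dB f g = sym (indicator-yes dB (f a))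
indicator-cong (no ¬a) dB f g = sym (indicator-no dB (¬a ∘ g))

indicator-∈-∷ : ∀ x y L v → y ∉ L → indicator (x ∈? (y ∷ L)) v ≡ indicator (x ≟ y) v + indicator (x ∈? L) v
indicator-∈-∷ x y L v y∉L = split (x ≟ y) (x ∈? L)
  where
  split : (x≟y : Dec (x ≡ y)) (x∈?L : Dec (x ∈ L)) →
          indicator (x ∈? (y ∷ L)) v ≡ indicator x≟y v + indicator x∈?L v
  split (yes refl) (yes x∈L) = ⊥-elim (y∉L x∈L)
  split (yes refl) (no _)    = trans (indicator-yes (x ∈? (y ∷ L)) (here refl)) (sym (+-identityʳ v))
  split (no x≢y)   (yes x∈L) = indicator-yes (x ∈? (y ∷ L)) (there x∈L)
  split (no x≢y)   (no x∉L)  =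
    indicator-no (x ∈? (y ∷ L)) λ { (here x≡y) → x≢y x≡y ; (there x∈L) → x∉L x∈L }

∑-indicator-≟ : ∀ M (w : ℕ → ℕ) y → 1 ≤ y → y ≤ M → ∑[ i < M ] indicator (suc i ≟ y) (w (suc i)) ≡ w y
∑-indicator-≟ M w (suc y) _ y<M =
  trans (∑-single M _ y y<M (λ i _ i≢y → indicator-no (suc i ≟ suc y) (i≢y ∘ suc-injective)))
        (indicator-yes (suc y ≟ suc y) refl)

sum-map≡∑-indicator : ∀ (w : ℕ → ℕ) M L → Linked _<_ L → All (λ y → 1 ≤ y × y ≤ M) L →
  sum (map w L) ≡ ∑[ i < M ] indicator (suc i ∈? L) (w (suc i))
sum-map≡∑-indicator w M [] _ _ = sym (∑-zero M _ (λ i _ → indicator-no (suc i ∈? []) {w (suc i)} λ ()))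
sum-map≡∑-indicator w M (y ∷ L) l ((1≤y , y≤M) ∷ bounds) = begin
  w y + sum (map w L)
    ≡⟨ cong₂ _+_ (sym (∑-indicator-≟ M w y 1≤y y≤M)) (sum-map≡∑-indicator w M L (Linked.tail l) bounds) ⟩
  ∑[ i < M ] indicator (suc i ≟ y) (w (suc i)) + ∑[ i < M ] indicator (suc i ∈? L) (w (suc i))
    ≡⟨ sym (∑-distrib-+ M _ _) ⟩
  ∑[ i < M ] (indicator (suc i ≟ y) (w (suc i)) + indicator (suc i ∈? L) (w (suc i)))
    ≡⟨ ∑-cong M (λ i _ → sym (indicator-∈-∷ (suc i) y L (w (suc i)) (Linked<⇒head∉ l))) ⟩
  ∑[ i < M ] indicator (suc i ∈? (y ∷ L)) (w (suc i))
    ∎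
  where open ≡-Reasoning

length-filter≡sum-indicator : ∀ {P : ℕ → Set} (P? : Decidable P) L →
  length (filter P? L) ≡ sum (map (λ x → indicator (P? x) 1) L)
length-filter≡sum-indicator P? [] = refl
length-filter≡sum-indicator P? (x ∷ L) with P? x
... | yes _ = cong suc (length-filter≡sum-indicator P? L)
... | no _  = length-filter≡sum-indicator P? L

module Pairing (L : List ℕ) (k r : ℕ) where

  part : ℕ → ℕ
  part x = indicator (x ∈? L) x

  M : ℕ
  M = suc (k + r + k)

  low high : ℕ → ℕ
  low i  = k ∸ i
  high i = suc (k + r + i)

  excess : ℕ → ℕ
  excess i = part (low i) + part (high i) ∸ low i

  middle : ℕ
  middle = ∑[ j < r ] part (suc (k + j))

  ∑-part-by-pairs : ∑[ i < M ] part (suc i) ≡ ∑[ i < k ] (part (low i) + part (high i)) + middle + part M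
  ∑-part-by-pairs = begin
    ∑ M (part ∘ suc)
      ≡⟨ cong (λ l → ∑ l (part ∘ suc)) (M≡ k r) ⟩
    ∑ (k + (r + suc k)) (part ∘ suc)
      ≡⟨ ∑-split k _ (part ∘ suc) ⟩
    ∑ k (part ∘ suc) + ∑[ i < r + suc k ] part (suc (k + i))
      ≡⟨ cong (∑ k (part ∘ suc) +_) (∑-split r (suc k) _) ⟩
    ∑ k (part ∘ suc) + (middle + ∑[ i < suc k ] part (suc (k + (r + i))))
      ≡⟨ cong (λ x → ∑ k (part ∘ suc) + (middle + x)) (∑-snoc k _) ⟩
    ∑ k (part ∘ suc) + (middle + (∑[ i < k ] part (suc (k + (r + i))) + part (suc (k + (r + k)))))
      ≡⟨ cong₂ (λ x y → x + (middle + y)) lows (cong₂ _+_ highs (cong part (cong suc (sym (+-assoc k r k))))) ⟩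
    ∑ k (part ∘ low) + (middle + (∑ k (part ∘ high) + part M))
      ≡⟨ regroup (∑ k (part ∘ low)) middle (∑ k (part ∘ high)) (part M) ⟩
    ∑ k (part ∘ low) + ∑ k (part ∘ high) + middle + part M
      ≡⟨ cong (λ x → x + middle + part M) (sym (∑-distrib-+ k (part ∘ low) (part ∘ high))) ⟩
    ∑[ i < k ] (part (low i) + part (high i)) + middle + part M
      ∎
    where
    open ≡-Reasoning
    M≡ : ∀ k r → suc (k + r + k) ≡ k + (r + suc k)
    M≡ = solve-∀
    regroup : ∀ a b c d → a + (b + (c + d)) ≡ a + c + b + d
    regroup = solve-∀
    lows : ∑ k (part ∘ suc) ≡ ∑ k (part ∘ low)
    lows = trans (∑-reverse k (part ∘ suc)) (∑-cong k (λ i i<k → cong part (sym (+-∸-assoc 1 i<k))))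
    highs : ∑[ i < k ] part (suc (k + (r + i))) ≡ ∑ k (part ∘ high)
    highs = ∑-cong k (λ i _ → cong (part ∘ suc) (sym (+-assoc k r i)))

  low+high≡M : ∀ i → i < k → low i + high i ≡ M
  low+high≡M i i<k = begin
    low i + suc (k + r + i)        ≡⟨ shuffle (low i) k r i ⟩
    suc (k + r + (low i + i))      ≡⟨ cong (λ x → suc (k + r + x)) (m∸n+n≡m (<⇒≤ i<k)) ⟩
    M                              ∎
    where
    open ≡-Reasoning
    shuffle : ∀ a k r i → a + suc (k + r + i) ≡ suc (k + r + (a + i))
    shuffle = solve-∀

  high∸low : ∀ i → i < k → high i ∸ low i ≡ suc (i + r + i)
  high∸low i i<k = begin
    high i ∸ low i                          ≡⟨ cong (λ x → suc (x + r + i) ∸ low i) (sym (m∸n+n≡m (<⇒≤ i<k))) ⟩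
    suc (low i + i + r + i) ∸ low i         ≡⟨ cong (_∸ low i) (shuffle (low i) i r) ⟩
    low i + suc (i + r + i) ∸ low i         ≡⟨ m+n∸m≡n (low i) _ ⟩
    suc (i + r + i)                         ∎
    where
    open ≡-Reasoning
    shuffle : ∀ a i r → suc (a + i + r + i) ≡ a + suc (i + r + i)
    shuffle = solve-∀

  1≤low : ∀ i → i < k → 1 ≤ low i
  1≤low i i<k = subst (1 ≤_) (sym (+-∸-assoc 1 i<k)) (s≤s z≤n)

  low<high : ∀ i → low i < high i
  low<high i = s≤s (≤-trans (m∸n≤m k i) (≤-trans (m≤m+n k r) (m≤m+n (k + r) i)))

  high≤M : ∀ i → i < k → high i ≤ M
  high≤M i i<k = s≤s (+-monoʳ-≤ (k + r) (<⇒≤ i<k))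

  position : ∀ z → z ≤ M → z ≤ k ⊎ (∃ λ j → j < r × z ≡ suc (k + j)) ⊎ (∃ λ i → i ≤ k × z ≡ high i)
  position z z≤M with z ≤? k
  ... | yes z≤k = inj₁ z≤k
  ... | no z≰k with z ∸ suc k <? r
  ...   | yes d<r = inj₂ (inj₁ (z ∸ suc k , d<r , sym (m+[n∸m]≡n (≰⇒> z≰k))))
  ...   | no d≮r  = inj₂ (inj₂ (i , i≤k , z≡high))
    where
    d i : ℕ
    d = z ∸ suc k
    i = d ∸ r
    z≡high : z ≡ high i
    z≡high = begin
      z                     ≡⟨ sym (m+[n∸m]≡n (≰⇒> z≰k)) ⟩
      suc (k + d)           ≡⟨ cong (λ x → suc (k + x)) (sym (m+[n∸m]≡n (≮⇒≥ d≮r))) ⟩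
      suc (k + (r + i))     ≡⟨ cong suc (sym (+-assoc k r i)) ⟩
      high i                ∎
      where open ≡-Reasoning
    i≤k : i ≤ k
    i≤k = +-cancelˡ-≤ (k + r) i k (≤-pred (subst (_≤ M) z≡high z≤M))

  part-∈ : ∀ {x} → x ∈ L → part x ≡ x
  part-∈ {x} = indicator-yes (x ∈? L)

  part-∉ : ∀ {x} → x ∉ L → part x ≡ 0
  part-∉ {x} = indicator-no (x ∈? L)

  module OfUnrefinable (increasing : Linked _<_ L) (positive : All (0 <_) L)
                  (unrefinable : Unrefinable L) (maxPart≡M : maxPart L ≡ M) where

    M∈L : M ∈ L
    M∈L = subst (_∈ L) maxPart≡M (maxPart-∈-nonzero L (subst (0 <_) (sym maxPart≡M) (s≤s z≤n)))

    ∈⇒≤M : ∀ {x} → x ∈ L → x ≤ M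
    ∈⇒≤M x∈L = subst (_ ≤_) maxPart≡M (≤-maxPart L x∈L)

    parts-within : All (λ x → 1 ≤ x × x ≤ M) L
    parts-within = All.tabulate (λ x∈L → All.lookup positive x∈L , ∈⇒≤M x∈L)

    pair-covered : ∀ i → i < k → low i ∈ L ⊎ high i ∈ L
    pair-covered i i<k with low i ∈? L | high i ∈? L
    ... | yes low∈ | _        = inj₁ low∈
    ... | no _     | yes high∈ = inj₂ high∈
    ... | no low∉  | no high∉  = ⊥-elim (unrefinable
      (M , low i , high i , M∈L , (1≤low i i<k , bounded (<⇒≤ (low<high i)) , low∉) ,
       (≤-trans (1≤low i i<k) (<⇒≤ (low<high i)) , bounded ≤-refl , high∉) ,
       <⇒≢ (low<high i) , sym (low+high≡M i i<k)))
      where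
      bounded : ∀ {x} → x ≤ high i → x ≤ maxPart L
      bounded x≤high = subst (_ ≤_) (sym maxPart≡M) (≤-trans x≤high (high≤M i i<k))

    excess-lowOnly : ∀ {i} → low i ∈ L → high i ∉ L → excess i ≡ 0
    excess-lowOnly {i} low∈ high∉ = begin
      part (low i) + part (high i) ∸ low i  ≡⟨ cong₂ (λ a b → a + b ∸ low i) (part-∈ low∈) (part-∉ high∉) ⟩
      low i + 0 ∸ low i                     ≡⟨ m+n∸m≡n (low i) 0 ⟩
      0                                     ∎
      where open ≡-Reasoning

    excess-highOnly : ∀ {i} → i < k → low i ∉ L → high i ∈ L → excess i ≡ suc (i + r + i)
    excess-highOnly {i} i<k low∉ high∈ = begin
      part (low i) + part (high i) ∸ low i  ≡⟨ cong₂ (λ a b → a + b ∸ low i) (part-∉ low∉) (part-∈ high∈) ⟩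
      high i ∸ low i                        ≡⟨ high∸low i i<k ⟩
      suc (i + r + i)                       ∎
      where open ≡-Reasoning

    excess-both : ∀ {i} → low i ∈ L → high i ∈ L → excess i ≡ high i
    excess-both {i} low∈ high∈ = begin
      part (low i) + part (high i) ∸ low i  ≡⟨ cong₂ (λ a b → a + b ∸ low i) (part-∈ low∈) (part-∈ high∈) ⟩
      low i + high i ∸ low i                ≡⟨ m+n∸m≡n (low i) (high i) ⟩
      high i                                ∎
      where open ≡-Reasoning

    data PairType (i : ℕ) : Set where
      lowOnly  : low i ∈ L → high i ∉ L → excess i ≡ 0 → PairType i
      highOnly : low i ∉ L → high i ∈ L → excess i ≡ suc (i + r + i) → PairType i
      both     : low i ∈ L → high i ∈ L → excess i ≡ high i → PairType i

    pairType : ∀ i → i < k → PairType i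
    pairType i i<k with low i ∈? L | high i ∈? L | pair-covered i i<k
    ... | yes low∈ | no high∉  | _          = lowOnly low∈ high∉ (excess-lowOnly low∈ high∉)
    ... | no low∉  | yes high∈ | _          = highOnly low∉ high∈ (excess-highOnly i<k low∉ high∈)
    ... | yes low∈ | yes high∈ | _          = both low∈ high∈ (excess-both low∈ high∈)
    ... | no low∉  | no _      | inj₁ low∈  = ⊥-elim (low∉ low∈)
    ... | no _     | no high∉  | inj₂ high∈ = ⊥-elim (high∉ high∈)

    low≤pair : ∀ i → i < k → low i ≤ part (low i) + part (high i)
    low≤pair i i<k with pair-covered i i<k
    ... | inj₁ low∈  = subst (λ x → low i ≤ x + part (high i)) (sym (part-∈ low∈)) (m≤m+n _ _)
    ... | inj₂ high∈ =
      subst (λ x → low i ≤ part (low i) + x) (sym (part-∈ high∈)) (≤-trans (<⇒≤ (low<high i)) (m≤n+m _ _))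

    missing⇒complement∈ : ∀ {a} → 1 ≤ a → a ≤ k → a ∉ L → M ∸ a ∈ L
    missing⇒complement∈ {a} 1≤a a≤k a∉L with pair-covered (k ∸ a) (∸-monoʳ-< 1≤a a≤k)
    ... | inj₁ low∈  = ⊥-elim (a∉L (subst (_∈ L) (m∸[m∸n]≡n a≤k) low∈))
    ... | inj₂ high∈ = subst (_∈ L) high≡M∸a high∈
      where
      high≡M∸a : high (k ∸ a) ≡ M ∸ a
      high≡M∸a = begin
        high (k ∸ a)                       ≡⟨ sym (m+n∸m≡n a _) ⟩
        a + high (k ∸ a) ∸ a               ≡⟨ cong (λ x → x + high (k ∸ a) ∸ a) (sym (m∸[m∸n]≡n a≤k)) ⟩
        low (k ∸ a) + high (k ∸ a) ∸ a     ≡⟨ cong (_∸ a) (low+high≡M (k ∸ a) (∸-monoʳ-< 1≤a a≤k)) ⟩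
        M ∸ a                              ∎
        where open ≡-Reasoning

    sum≡tri+excess+middle+M : sum L ≡ tri k + ∑ k excess + middle + M
    sum≡tri+excess+middle+M = begin
      sum L
        ≡⟨ cong sum (sym (map-id L)) ⟩
      sum (map (λ x → x) L)
        ≡⟨ sum-map≡∑-indicator (λ x → x) M L increasing parts-within ⟩
      ∑ M (part ∘ suc)
        ≡⟨ ∑-part-by-pairs ⟩
      ∑[ i < k ] (part (low i) + part (high i)) + middle + part M
        ≡⟨ cong₂ (λ x y → x + middle + y) (∑-cong k (λ i i<k → sym (m+[n∸m]≡n (low≤pair i i<k)))) (part-∈ M∈L) ⟩
      ∑[ i < k ] (low i + excess i) + middle + M
        ≡⟨ cong (λ x → x + middle + M) (∑-distrib-+ k low excess) ⟩
      ∑ k low + ∑ k excess + middle + M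
        ≡⟨ cong (λ x → x + ∑ k excess + middle + M) (∑-downFrom≡tri k) ⟩
      tri k + ∑ k excess + middle + M
        ∎
      where open ≡-Reasoning

    excess-small⇒0 : ∀ i → i < k → excess i < suc (i + r + i) → excess i ≡ 0
    excess-small⇒0 i i<k small with pairType i i<k
    ... | lowOnly _ _ e≡0 = e≡0
    ... | highOnly _ _ e≡ = ⊥-elim (<-irrefl e≡ small)
    ... | both _ _ e≡high = ⊥-elim (<⇒≱ small (subst (suc (i + r + i) ≤_) (sym e≡high)
                                 (s≤s (+-monoˡ-≤ i (+-monoˡ-≤ r (<⇒≤ i<k))))))

    excess≡0⇒lowOnly : ∀ i → i < k → excess i ≡ 0 → low i ∈ L × high i ∉ L
    excess≡0⇒lowOnly i i<k e≡0 with pairType i i<k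
    ... | lowOnly low∈ high∉ _ = low∈ , high∉
    ... | highOnly _ _ e≡ with () ← trans (sym e≡) e≡0
    ... | both _ _ e≡     with () ← trans (sym e≡) e≡0

    middle≡0⊎suc-k : r ≤ 1 → middle ≡ 0 ⊎ middle ≡ suc k
    middle≡0⊎suc-k z≤n = inj₁ refl
    middle≡0⊎suc-k (s≤s z≤n) with indicator-zero⊎id (suc (k + 0) ∈? L) (suc (k + 0))
    ... | inj₁ p≡0 = inj₁ (trans (+-identityʳ _) p≡0)
    ... | inj₂ p≡v = inj₂ (trans (+-identityʳ _) (trans p≡v (cong suc (+-identityʳ k))))

    ∑excess≡excess₀ : 0 < k → ∑ k excess ≤ 2 → ∑ k excess ≡ excess 0
    ∑excess≡excess₀ 0<k ∑excess≤2 = ∑-single k excess 0 0<k λ where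
      zero    _   0≢0 → ⊥-elim (0≢0 refl)
      (suc j) j<k _   → excess-small⇒0 (suc j) j<k
        (≤-trans (s≤s (term≤∑ k excess (suc j) j<k))
                 (≤-trans (s≤s ∑excess≤2) (s≤s (s≤s (≤-trans (s≤s z≤n) (m≤n+m (suc j) (j + r)))))))

    excess₀+r≢2 : 2 ≤ k → r ≤ 1 → excess 0 + r ≢ 2
    excess₀+r≢2 2≤k r≤1 eq with pairType 0 (≤-trans (s≤s z≤n) 2≤k) | r≤1
    ... | lowOnly _ _ e≡0  | z≤n     with () ← trans (cong (_+ 0) (sym e≡0)) eq
    ... | lowOnly _ _ e≡0  | s≤s z≤n with () ← trans (cong (_+ 1) (sym e≡0)) eq
    ... | highOnly _ _ e≡  | z≤n     with () ← trans (cong (_+ 0) (sym e≡)) eq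
    ... | highOnly _ _ e≡  | s≤s z≤n with () ← trans (cong (_+ 1) (sym e≡)) eq
    ... | both _ _ e≡high  | _       =
      <⇒≱ (s≤s (≤-trans 2≤k (≤-trans (m≤m+n k r) (m≤m+n (k + r) 0))))
          (≤-trans (m≤m+n _ r) (subst (_≤ 2) (cong (_+ r) e≡high) (≤-reflexive eq)))

    ∑excess+middle+r≢2 : 2 ≤ k → r ≤ 1 → ∑ k excess + middle + r ≢ 2
    ∑excess+middle+r≢2 2≤k r≤1 total≡2 with middle≡0⊎suc-k r≤1
    ... | inj₂ middle≡suc-k = <⇒≱ 2≤k (≤-pred (subst (_≤ 2) middle≡suc-k middle≤2))
      where
      middle≤2 : middle ≤ 2
      middle≤2 = subst (middle ≤_) total≡2 (≤-trans (m≤n+m middle (∑ k excess)) (m≤m+n _ r))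
    ... | inj₁ middle≡0 = excess₀+r≢2 2≤k r≤1 (begin
      excess 0 + r               ≡⟨ cong (_+ r) (sym (∑excess≡excess₀ (≤-trans (s≤s z≤n) 2≤k) ∑excess≤2)) ⟩
      ∑ k excess + r             ≡⟨ cong (λ x → x + r) (sym (trans (cong (∑ k excess +_) middle≡0) (+-identityʳ _))) ⟩
      ∑ k excess + middle + r    ≡⟨ total≡2 ⟩
      2                          ∎)
      where
      open ≡-Reasoning
      ∑excess≤2 : ∑ k excess ≤ 2
      ∑excess≤2 = subst (∑ k excess ≤_) total≡2 (≤-trans (m≤m+n _ middle) (m≤m+n _ r))

    tri+M≤sum : tri k + M ≤ sum L
    tri+M≤sum = ≤-trans (m≤m+n (tri k + M) (∑ k excess + middle))
                        (≤-reflexive (trans (regroup (tri k) M (∑ k excess) middle) (sym sum≡tri+excess+middle+M)))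
      where
      regroup : ∀ t M E c → t + M + (E + c) ≡ t + E + c + M
      regroup = solve-∀

    no-large-maximum : ∀ m → r ≤ 1 → 8 + (m + m) < M → sum L ≢ tri (6 + m)
    no-large-maximum m r≤1 M-large sum≡ with 5 + m ≤? k
    ... | yes 5+m≤k = <⇒≱ tri<tri+M (≤-trans tri+M≤sum (≤-reflexive sum≡))
      where
      tri<tri+M : tri (6 + m) < tri k + M
      tri<tri+M = begin-strict
        tri (6 + m)              ≤⟨ tri-mono-≤ (s≤s 5+m≤k) ⟩
        suc k + tri k            <⟨ m<m+n (suc k + tri k) (≤-trans (s≤s z≤n) 5+m≤k) ⟩
        suc k + tri k + k        ≤⟨ m≤m+n _ r ⟩
        suc k + tri k + k + r    ≡⟨ regroup k (tri k) r ⟩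
        tri k + M                ∎
        where
        open ≤-Reasoning
        regroup : ∀ k t r → suc k + t + k + r ≡ t + suc (k + r + k)
        regroup = solve-∀
    ... | no k≱5+m with k≡4+m
      where
      k≡4+m : k ≡ 4 + m
      k≡4+m with m≤n⇒m<n∨m≡n (≤-pred (≰⇒> k≱5+m))
      ... | inj₂ k≡ = k≡
      ... | inj₁ (s≤s k≤3+m) = ⊥-elim (<⇒≱ M-large (s≤s (≤-trans (+-mono-≤ (+-mono-≤ k≤3+m r≤1) k≤3+m)
                                                                (≤-reflexive (regroup m)))))
        where
        regroup : ∀ m → 3 + m + 1 + (3 + m) ≡ 7 + (m + m)
        regroup = solve-∀
    ... | refl = ∑excess+middle+r≢2 (s≤s (s≤s z≤n)) r≤1
                   (+-cancelˡ-≡ (tri (4 + m) + suc (4 + m + (4 + m))) _ _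
                     (trans (regroup (tri (4 + m)) (∑ (4 + m) excess) middle m r)
                            (trans (trans (sym sum≡tri+excess+middle+M) sum≡) (split-tri m (tri (4 + m))))))
      where
      regroup : ∀ t E c m r → t + suc (4 + m + (4 + m)) + (E + c + r) ≡ t + E + c + suc (4 + m + r + (4 + m))
      regroup = solve-∀
      split-tri : ∀ m t → 6 + m + (5 + m + t) ≡ t + suc (4 + m + (4 + m)) + 2
      split-tri = solve-∀

maxPart-unrefinable≤2n∸4 : ∀ m μ → IsUnrefinablePartition (T (6 + m)) μ → maxPart μ ≤ 8 + (m + m)
maxPart-unrefinable≤2n∸4 m μ (partition , unrefinable) = bounded (maxPart μ) refl
  where
  open IsDistinctPartition partition
  bounded : ∀ x → maxPart μ ≡ x → x ≤ 8 + (m + m)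
  bounded zero     _ = z≤n
  bounded (suc M′) maxPart≡ with split-half M′
  ... | k , r , r≤1 , refl =
    ≮⇒≥ (λ M-large → no-large-maximum m r≤1 M-large (trans sumIsN (T≡tri (6 + m))))
    where
    open Pairing μ k r
    open OfUnrefinable increasing positive unrefinable maxPart≡

module PiTilde (m : ℕ) where

  2n∸4≡8+2m : 2 * (6 + m) ∸ 4 ≡ 8 + (m + m)
  2n∸4≡8+2m = normalise m
    where
    normalise : ∀ m → suc (suc (m + (6 + (m + 0)))) ≡ 8 + (m + m)
    normalise = solve-∀

  piTilde≡ : piTilde (6 + m) ≡ applyUpTo suc (3 + m) ++ 7 + m ∷ 8 + (m + m) ∷ []
  piTilde≡ = cong₂ (λ xs z → xs ++ 7 + m ∷ z ∷ []) (map-upTo suc (3 + m)) 2n∸4≡8+2m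

  ∈-piTilde⁻ : ∀ {x} → x ∈ piTilde (6 + m) → (1 ≤ x × x ≤ 3 + m) ⊎ x ≡ 7 + m ⊎ x ≡ 8 + (m + m)
  ∈-piTilde⁻ {x} x∈ with ∈-++⁻ (applyUpTo suc (3 + m)) (subst (x ∈_) piTilde≡ x∈)
  ... | inj₁ x∈init with Any.applyUpTo⁻ suc x∈init
  ...   | i , i<3+m , refl = inj₁ (s≤s z≤n , i<3+m)
  ∈-piTilde⁻ x∈ | inj₂ (here x≡)         = inj₂ (inj₁ x≡)
  ∈-piTilde⁻ x∈ | inj₂ (there (here x≡)) = inj₂ (inj₂ x≡)

  ∈-piTilde⁺ : ∀ {x} → (1 ≤ x × x ≤ 3 + m) ⊎ x ≡ 7 + m ⊎ x ≡ 8 + (m + m) → x ∈ piTilde (6 + m)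
  ∈-piTilde⁺ {x} cases = subst (x ∈_) (sym piTilde≡) (in-cases cases)
    where
    in-cases : (1 ≤ x × x ≤ 3 + m) ⊎ x ≡ 7 + m ⊎ x ≡ 8 + (m + m) →
               x ∈ applyUpTo suc (3 + m) ++ 7 + m ∷ 8 + (m + m) ∷ []
    in-cases (inj₁ (s≤s z≤n , x≤3+m)) = ∈-++⁺ˡ (Any.applyUpTo⁺ suc refl x≤3+m)
    in-cases (inj₂ (inj₁ x≡))         = ∈-++⁺ʳ (applyUpTo suc (3 + m)) (here x≡)
    in-cases (inj₂ (inj₂ x≡))         = ∈-++⁺ʳ (applyUpTo suc (3 + m)) (there (here x≡))

  ∈-piTilde⇒≤ : ∀ {x} → x ∈ piTilde (6 + m) → x ≤ 8 + (m + m)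
  ∈-piTilde⇒≤ x∈ with ∈-piTilde⁻ x∈
  ... | inj₁ (_ , x≤3+m) = ≤-trans x≤3+m (≤-trans (m≤n+m (3 + m) 5) (+-monoʳ-≤ 8 (m≤m+n m m)))
  ... | inj₂ (inj₁ refl) = +-monoʳ-≤ 7 (≤-trans (m≤m+n m m) (n≤1+n _))
  ... | inj₂ (inj₂ refl) = ≤-refl

  maxPart-piTilde : maxPart (piTilde (6 + m)) ≡ 8 + (m + m)
  maxPart-piTilde = ≤-antisym (maxPart-≤ (piTilde (6 + m)) (All.tabulate ∈-piTilde⇒≤))
                              (≤-maxPart (piTilde (6 + m)) (∈-piTilde⁺ (inj₂ (inj₂ refl))))

  piTilde-isDistinctPartition : IsDistinctPartition (T (6 + m)) (piTilde (6 + m))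
  piTilde-isDistinctPartition = record
    { increasing = subst (Linked _<_) (sym piTilde≡) (AllPairs⇒Linked
        (AllPairs.++⁺ (AllPairs.applyUpTo⁺₁ suc (3 + m) (λ i<j _ → s≤s i<j))
                      ((7+m<8+2m ∷ []) ∷ [] ∷ [])
                      (All.applyUpTo⁺₁ suc (3 + m) λ i<3+m →
                        let i<7+m = s≤s (≤-trans i<3+m (m≤n+m (3 + m) 3))
                        in i<7+m ∷ <-trans i<7+m 7+m<8+2m ∷ [])))
    ; positive   = All.tabulate ∈⇒positive
    ; atLeastTwo = subst (λ xs → 2 ≤ length xs) (sym piTilde≡)
                         (length-++-≤ʳ (7 + m ∷ 8 + (m + m) ∷ []) {applyUpTo suc (3 + m)})
    ; sumIsN     = begin
        sum (piTilde (6 + m))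
          ≡⟨ cong sum piTilde≡ ⟩
        sum (applyUpTo suc (3 + m) ++ 7 + m ∷ 8 + (m + m) ∷ [])
          ≡⟨ sum-++ (applyUpTo suc (3 + m)) _ ⟩
        sum (applyUpTo suc (3 + m)) + (7 + m + (8 + (m + m) + 0))
          ≡⟨ cong (_+ (7 + m + (8 + (m + m) + 0))) (trans (sum-applyUpTo suc (3 + m)) (∑-upTo≡tri (3 + m))) ⟩
        tri (3 + m) + (7 + m + (8 + (m + m) + 0))
          ≡⟨ regroup (tri (3 + m)) m ⟩
        tri (6 + m)
          ≡⟨ sym (T≡tri (6 + m)) ⟩
        T (6 + m)
          ∎
    }
    where
    open ≡-Reasoning
    7+m<8+2m : 7 + m < 8 + (m + m)
    7+m<8+2m = s≤s (+-monoʳ-≤ 7 (m≤m+n m m))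
    ∈⇒positive : ∀ {x} → x ∈ piTilde (6 + m) → 0 < x
    ∈⇒positive x∈ with ∈-piTilde⁻ x∈
    ... | inj₁ (1≤x , _)   = 1≤x
    ... | inj₂ (inj₁ refl) = s≤s z≤n
    ... | inj₂ (inj₂ refl) = s≤s z≤n
    regroup : ∀ t m → t + (7 + m + (8 + (m + m) + 0)) ≡ 6 + m + (5 + m + (4 + m + t))
    regroup = solve-∀

  piTilde-unrefinable : Unrefinable (piTilde (6 + m))
  piTilde-unrefinable (p , x , y , p∈ , (1≤x , _ , x∉) , (1≤y , _ , y∉) , x≢y , refl) =
    <⇒≱ (distinct-lowerBound-+ (large 1≤x x∉) (large 1≤y y∉) x≢y)
        (≤-trans (≤-maxPart (piTilde (6 + m)) p∈) (≤-reflexive (trans maxPart-piTilde (regroup m))))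
    where
    large : ∀ {z} → 1 ≤ z → z ∉ piTilde (6 + m) → 4 + m ≤ z
    large {z} 1≤z z∉ = ≰⇒> (λ z≤3+m → z∉ (∈-piTilde⁺ (inj₁ (1≤z , z≤3+m))))
    regroup : ∀ m → 8 + (m + m) ≡ 4 + m + (4 + m)
    regroup = solve-∀

TopTriple : ℕ → ℕ → ℕ → ℕ → Set
TopTriple n x y z = (x ≡ n ∸ 4 × y ≡ n ∸ 3 × z ≡ n ∸ 2) ⊎
                    (x ≡ n ∸ 4 × y ≡ n ∸ 2 × z ≡ n ∸ 1) ⊎
                    (x ≡ n ∸ 3 × y ≡ n ∸ 2 × z ≡ n) ⊎
                    (x ≡ n ∸ 2 × y ≡ n ∸ 1 × z ≡ n)

RemovedStructure : ℕ → List ℕ → Set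
RemovedStructure n λs =
  replacements n λs ≡ length (removed n λs) ∸ 2 ×
  Σ (List ℕ) λ pre → Σ ℕ λ x → Σ ℕ λ y → Σ ℕ λ z →
    (removed n λs ≡ pre ++ (x ∷ y ∷ z ∷ [])) × All (λ a → (2 * n ∸ 4 ∸ a) ∈ λs) pre × TopTriple n x y z

module Maximal (m : ℕ) (λs : List ℕ) (λs-unrefinable : IsUnrefinablePartition (T (6 + m)) λs)
               (maxPart≡2n∸4 : maxPart λs ≡ 8 + (m + m)) where

  open IsDistinctPartition (proj₁ λs-unrefinable)
  open Pairing λs (3 + m) 1
  open PiTilde m

  8+2m≡M : 8 + (m + m) ≡ M
  8+2m≡M = normalise m
    where
    normalise : ∀ m → 8 + (m + m) ≡ suc (3 + m + 1 + (3 + m))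
    normalise = solve-∀

  open OfUnrefinable increasing positive (proj₂ λs-unrefinable) (trans maxPart≡2n∸4 8+2m≡M)

  PiTildePairs ExclusivePairs : Set
  PiTildePairs   = (∀ i → i < 3 + m → i ≢ 2 → low i ∈ λs × high i ∉ λs) × low 2 ∈ λs × high 2 ∈ λs
  ExclusivePairs = ∀ i → i < 3 + m → ¬ (low i ∈ λs × high i ∈ λs)

  ∑excess+middle≡7+m : ∑ (3 + m) excess + middle ≡ 7 + m
  ∑excess+middle≡7+m = +-cancelˡ-≡ (tri (3 + m) + M) _ _ (begin
    tri (3 + m) + M + (∑ (3 + m) excess + middle)  ≡⟨ regroup (tri (3 + m)) M (∑ (3 + m) excess) middle ⟩
    tri (3 + m) + ∑ (3 + m) excess + middle + M    ≡⟨ sym sum≡tri+excess+middle+M ⟩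
    sum λs                                         ≡⟨ trans sumIsN (T≡tri (6 + m)) ⟩
    tri (6 + m)                                    ≡⟨ split-tri (tri (3 + m)) m ⟩
    tri (3 + m) + M + (7 + m)                      ∎)
    where
    open ≡-Reasoning
    regroup : ∀ t M E c → t + M + (E + c) ≡ t + E + c + M
    regroup = solve-∀
    split-tri : ∀ t m → 6 + m + (5 + m + (4 + m + t)) ≡ t + suc (3 + m + 1 + (3 + m)) + (7 + m)
    split-tri = solve-∀

  2∣excess-unlessBoth : ∀ i → i < 3 + m → ¬ (low i ∈ λs × high i ∈ λs) → 2 ∣ excess i
  2∣excess-unlessBoth i i<k not-both with pairType i i<k
  ... | lowOnly _ _ e≡0     = divides 0 e≡0
  ... | highOnly _ _ e≡     = divides (suc i) (trans e≡ (double i))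
    where
    double : ∀ i → suc (i + 1 + i) ≡ suc i * 2
    double = solve-∀
  ... | both low∈ high∈ _   = ⊥-elim (not-both (low∈ , high∈))

  2∣∑excess-unlessBoth : ExclusivePairs → 2 ∣ ∑ (3 + m) excess
  2∣∑excess-unlessBoth no-both = ∑-divisible (3 + m) excess (λ i i<k → 2∣excess-unlessBoth i i<k (no-both i i<k))

  middle≡0 : middle ≡ 0
  middle≡0 with middle≡0⊎suc-k (s≤s z≤n)
  ... | inj₁ middle≡0      = middle≡0
  ... | inj₂ middle≡suc-k =
    ⊥-elim (2∣n⇒2∤1+n (divides 1 refl) (subst (2 ∣_) ∑excess≡3 (2∣∑excess-unlessBoth no-both)))
    where
    ∑excess≡3 : ∑ (3 + m) excess ≡ 3
    ∑excess≡3 = +-cancelʳ-≡ (4 + m) _ 3 (trans (cong (∑ (3 + m) excess +_) (sym middle≡suc-k)) ∑excess+middle≡7+m)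
    no-both : ExclusivePairs
    no-both i i<k (low∈ , high∈) =
      <⇒≱ (s≤s (s≤s (s≤s (s≤s z≤n))))
          (subst (_≤ 3) (excess-both low∈ high∈) (subst (excess i ≤_) ∑excess≡3 (term≤∑ (3 + m) excess i i<k)))

  ∑excess≡7+m : ∑ (3 + m) excess ≡ 7 + m
  ∑excess≡7+m = trans (sym (+-identityʳ _)) (trans (cong (∑ (3 + m) excess +_) (sym middle≡0)) ∑excess+middle≡7+m)

  module _ {i₀} (i₀<k : i₀ < 3 + m) (low∈ : low i₀ ∈ λs) (high∈ : high i₀ ∈ λs) where

    both⇒others≡0 : ∀ i → i < 3 + m → i ≢ i₀ → excess i ≡ 0
    both⇒others≡0 i i<k i≢i₀ = excess-small⇒0 i i<k (small i i₀ i≢i₀ excess+i₀≤2)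
      where
      excess+i₀≤2 : excess i + i₀ ≤ 2
      excess+i₀≤2 = +-cancelˡ-≤ (5 + m) _ 2 (begin
        5 + m + (excess i + i₀)      ≡⟨ regroup m (excess i) i₀ ⟩
        excess i + high i₀           ≡⟨ cong (excess i +_) (sym (excess-both low∈ high∈)) ⟩
        excess i + excess i₀         ≤⟨ twoTerms≤∑ (3 + m) excess i i₀ i<k i₀<k i≢i₀ ⟩
        ∑ (3 + m) excess             ≡⟨ ∑excess≡7+m ⟩
        2 + (5 + m)                  ≡⟨ +-comm 2 (5 + m) ⟩
        5 + m + 2                    ∎)
        where
        open ≤-Reasoning
        regroup : ∀ m e i → 5 + m + (e + i) ≡ e + suc (3 + m + 1 + i)
        regroup = solve-∀
      small : ∀ i j → i ≢ j → excess i + j ≤ 2 → excess i < suc (i + 1 + i)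
      small zero    zero    0≢0 _      = ⊥-elim (0≢0 refl)
      small zero    (suc j) _   e+j≤2  =
        ≤-trans (≤-reflexive (+-comm 1 (excess 0))) (≤-trans (+-monoʳ-≤ (excess 0) (s≤s z≤n)) e+j≤2)
      small (suc i) j       _   e+j≤2  =
        s≤s (≤-trans (≤-trans (m≤m+n _ j) e+j≤2) (s≤s (≤-trans (s≤s z≤n) (m≤n+m (suc i) (i + 1)))))

    both⇒index≡2 : i₀ ≡ 2
    both⇒index≡2 = +-cancelˡ-≡ (5 + m) i₀ 2 (begin
      5 + m + i₀                 ≡⟨ regroup m i₀ ⟩
      high i₀                    ≡⟨ sym (excess-both low∈ high∈) ⟩
      excess i₀                  ≡⟨ sym (∑-single (3 + m) excess i₀ i₀<k both⇒others≡0) ⟩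
      ∑ (3 + m) excess           ≡⟨ ∑excess≡7+m ⟩
      2 + (5 + m)                ≡⟨ +-comm 2 (5 + m) ⟩
      5 + m + 2                  ∎)
      where
      open ≡-Reasoning
      regroup : ∀ m i → 5 + m + i ≡ suc (3 + m + 1 + i)
      regroup = solve-∀

  data Shape : Set where
    piTildeShape   : PiTildePairs → Shape
    exclusiveShape : 2 ∣ 7 + m → ExclusivePairs → Shape

  shape : Shape
  shape = classify (anyUpTo? (λ i → low i ∈? λs ×-dec high i ∈? λs) (3 + m))
    where
    classify : Dec (∃ λ i → i < 3 + m × low i ∈ λs × high i ∈ λs) → Shape
    classify (no none) = exclusiveShape (subst (2 ∣_) ∑excess≡7+m (2∣∑excess-unlessBoth no-both)) no-both
      where
      no-both : ExclusivePairs
      no-both i i<k both∈ = none (i , i<k , both∈)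
    classify (yes (i₀ , i₀<k , low∈ , high∈)) = piTildeShape
      ( (λ i i<k i≢2 → excess≡0⇒lowOnly i i<k (both⇒others≡0 i₀<k low∈ high∈ i i<k (i≢2 ∘ λ i≡i₀ → trans i≡i₀ i₀≡2)))
      , subst (λ i → low i ∈ λs) i₀≡2 low∈
      , subst (λ i → high i ∈ λs) i₀≡2 high∈ )
      where
      i₀≡2 : i₀ ≡ 2
      i₀≡2 = both⇒index≡2 i₀<k low∈ high∈

  4+m∉ : 4 + m ∉ λs
  4+m∉ 4+m∈ with () ← trans (sym middle≡0)
                            (trans (+-identityʳ _) (part-∈ (subst (_∈ λs) (cong suc (sym (+-identityʳ (3 + m)))) 4+m∈)))

  high₂≡7+m : high 2 ≡ 7 + m
  high₂≡7+m = normalise m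
    where
    normalise : ∀ m → suc (3 + m + 1 + 2) ≡ 7 + m
    normalise = solve-∀

  piTildePairs⇒≡piTilde : PiTildePairs → λs ≡ piTilde (6 + m)
  piTildePairs⇒≡piTilde (others-lowOnly , low₂∈ , high₂∈) =
    Linked<-≡ λs (piTilde (6 + m)) increasing (IsDistinctPartition.increasing piTilde-isDistinctPartition) ⊆ ⊇
    where
    ⊆ : ∀ {z} → z ∈ λs → z ∈ piTilde (6 + m)
    ⊆ {z} z∈ with position z (∈⇒≤M z∈)
    ... | inj₁ z≤3+m = ∈-piTilde⁺ (inj₁ (All.lookup positive z∈ , z≤3+m))
    ... | inj₂ (inj₁ (zero , _ , refl)) = ⊥-elim (4+m∉ (subst (_∈ λs) (cong suc (+-identityʳ (3 + m))) z∈))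
    ... | inj₂ (inj₁ (suc _ , s≤s () , _))
    ... | inj₂ (inj₂ (i , i≤k , refl)) with m≤n⇒m<n∨m≡n i≤k
    ...   | inj₂ refl    = ∈-piTilde⁺ (inj₂ (inj₂ (sym 8+2m≡M)))
    ...   | inj₁ i<k with i ≟ 2
    ...     | yes refl = ∈-piTilde⁺ (inj₂ (inj₁ high₂≡7+m))
    ...     | no i≢2   = ⊥-elim (proj₂ (others-lowOnly i i<k i≢2) z∈)
    ⊇ : ∀ {z} → z ∈ piTilde (6 + m) → z ∈ λs
    ⊇ {z} z∈ with ∈-piTilde⁻ z∈
    ... | inj₂ (inj₁ refl)   = subst (_∈ λs) high₂≡7+m high₂∈
    ... | inj₂ (inj₂ refl)   = subst (_∈ λs) (sym 8+2m≡M) M∈L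
    ... | inj₁ (1≤z , z≤3+m) = subst (_∈ λs) (m∸[m∸n]≡n z≤3+m) (low∈ (3 + m ∸ z) (∸-monoʳ-< 1≤z z≤3+m))
      where
      low∈ : ∀ j → j < 3 + m → low j ∈ λs
      low∈ j j<k with j ≟ 2
      ... | yes refl = low₂∈
      ... | no j≢2   = proj₁ (others-lowOnly j j<k j≢2)

  module Exclusive (exclusive : ExclusivePairs) where

    notPart? : Decidable (_∉ λs)
    notPart? a = ¬? (a ∈? λs)

    initial : List ℕ
    initial = filter notPart? (applyUpTo suc (1 + m))

    oneTo≡ : oneTo (6 + m) ≡ applyUpTo suc (1 + m) ++ 2 + m ∷ 3 + m ∷ 4 + m ∷ 5 + m ∷ 6 + m ∷ []
    oneTo≡ = begin
      map suc (upTo (6 + m))                                  ≡⟨ map-upTo suc (6 + m) ⟩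
      applyUpTo suc (5 + suc m)                               ≡⟨ cong (applyUpTo suc) (+-comm 5 (suc m)) ⟩
      applyUpTo suc (suc m + 5)                               ≡⟨ applyUpTo-++ suc (suc m) 5 ⟩
      applyUpTo suc (1 + m) ++ applyUpTo (λ i → suc (suc m + i)) 5
        ≡⟨ cong (applyUpTo suc (1 + m) ++_) (applyUpTo-cong 5 (λ i → cong suc (+-comm (suc m) i))) ⟩
      applyUpTo suc (1 + m) ++ 2 + m ∷ 3 + m ∷ 4 + m ∷ 5 + m ∷ 6 + m ∷ []  ∎
      where open ≡-Reasoning

    removed≡ : removed (6 + m) λs ≡ initial ++ filter notPart? (2 + m ∷ 3 + m ∷ 4 + m ∷ 5 + m ∷ 6 + m ∷ [])
    removed≡ = trans (cong (filter notPart?) oneTo≡) (filter-++ notPart? (applyUpTo suc (1 + m)) _)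

    keep : ∀ {a} xs → a ∉ λs → filter notPart? (a ∷ xs) ≡ a ∷ filter notPart? xs
    keep xs a∉ = filter-accept notPart? a∉

    skip : ∀ {a} xs → a ∈ λs → filter notPart? (a ∷ xs) ≡ filter notPart? xs
    skip xs a∈ = filter-reject notPart? (λ a∉ → a∉ a∈)

    high∉ : ∀ {i} → i < 3 + m → low i ∈ λs → high i ∉ λs
    high∉ i<k low∈ high∈ = exclusive _ i<k (low∈ , high∈)

    high∈ : ∀ {i} → i < 3 + m → low i ∉ λs → high i ∈ λs
    high∈ i<k low∉ with pair-covered _ i<k
    ... | inj₁ low∈  = ⊥-elim (low∉ low∈)
    ... | inj₂ high∈ = high∈

    high₀≡5+m : high 0 ≡ 5 + m
    high₀≡5+m = normalise m
      where
      normalise : ∀ m → suc (3 + m + 1 + 0) ≡ 5 + m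
      normalise = solve-∀

    high₁≡6+m : high 1 ≡ 6 + m
    high₁≡6+m = normalise m
      where
      normalise : ∀ m → suc (3 + m + 1 + 1) ≡ 6 + m
      normalise = solve-∀

    5+m∉ : 3 + m ∈ λs → 5 + m ∉ λs
    5+m∉ 3+m∈ = subst (_∉ λs) high₀≡5+m (high∉ (s≤s z≤n) 3+m∈)

    5+m∈ : 3 + m ∉ λs → 5 + m ∈ λs
    5+m∈ 3+m∉ = subst (_∈ λs) high₀≡5+m (high∈ (s≤s z≤n) 3+m∉)

    6+m∉ : 2 + m ∈ λs → 6 + m ∉ λs
    6+m∉ 2+m∈ = subst (_∉ λs) high₁≡6+m (high∉ (s≤s (s≤s z≤n)) 2+m∈)

    6+m∈ : 2 + m ∉ λs → 6 + m ∈ λs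
    6+m∈ 2+m∉ = subst (_∈ λs) high₁≡6+m (high∈ (s≤s (s≤s z≤n)) 2+m∉)

    top-removed : Σ ℕ λ x → Σ ℕ λ y → Σ ℕ λ z →
      filter notPart? (2 + m ∷ 3 + m ∷ 4 + m ∷ 5 + m ∷ 6 + m ∷ []) ≡ x ∷ y ∷ z ∷ [] × TopTriple (6 + m) x y z
    top-removed = by-pairs (2 + m ∈? λs) (3 + m ∈? λs)
      where
      l₃ l₄ l₅ l₆ : List ℕ
      l₆ = 6 + m ∷ []
      l₅ = 5 + m ∷ l₆
      l₄ = 4 + m ∷ l₅
      l₃ = 3 + m ∷ l₄
      by-pairs : Dec (2 + m ∈ λs) → Dec (3 + m ∈ λs) → Σ ℕ λ x → Σ ℕ λ y → Σ ℕ λ z →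
        filter notPart? (2 + m ∷ l₃) ≡ x ∷ y ∷ z ∷ [] × TopTriple (6 + m) x y z
      by-pairs (yes 2+m∈) (yes 3+m∈) = 4 + m , 5 + m , 6 + m ,
        trans (skip l₃ 2+m∈) (trans (skip l₄ 3+m∈) (trans (keep l₅ 4+m∉)
          (cong (4 + m ∷_) (trans (keep l₆ (5+m∉ 3+m∈)) (cong (5 + m ∷_) (keep [] (6+m∉ 2+m∈))))))) ,
        inj₂ (inj₂ (inj₂ (refl , refl , refl)))
      by-pairs (yes 2+m∈) (no 3+m∉) = 3 + m , 4 + m , 6 + m ,
        trans (skip l₃ 2+m∈) (trans (keep l₄ 3+m∉) (cong (3 + m ∷_) (trans (keep l₅ 4+m∉)
          (cong (4 + m ∷_) (trans (skip l₆ (5+m∈ 3+m∉)) (keep [] (6+m∉ 2+m∈))))))) ,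
        inj₂ (inj₂ (inj₁ (refl , refl , refl)))
      by-pairs (no 2+m∉) (yes 3+m∈) = 2 + m , 4 + m , 5 + m ,
        trans (keep l₃ 2+m∉) (cong (2 + m ∷_) (trans (skip l₄ 3+m∈) (trans (keep l₅ 4+m∉)
          (cong (4 + m ∷_) (trans (keep l₆ (5+m∉ 3+m∈)) (cong (5 + m ∷_) (skip [] (6+m∈ 2+m∉)))))))) ,
        inj₂ (inj₁ (refl , refl , refl))
      by-pairs (no 2+m∉) (no 3+m∉) = 2 + m , 3 + m , 4 + m ,
        trans (keep l₃ 2+m∉) (cong (2 + m ∷_) (trans (keep l₄ 3+m∉) (cong (3 + m ∷_) (trans (keep l₅ 4+m∉)
          (cong (4 + m ∷_) (trans (skip l₆ (5+m∈ 3+m∉)) (skip [] (6+m∈ 2+m∉)))))))) ,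
        inj₁ (refl , refl , refl)

    initial-replaced : All (λ a → 2 * (6 + m) ∸ 4 ∸ a ∈ λs) initial
    initial-replaced = All.tabulate replaced
      where
      replaced : ∀ {a} → a ∈ initial → 2 * (6 + m) ∸ 4 ∸ a ∈ λs
      replaced a∈ with ∈-filter⁻ notPart? {xs = applyUpTo suc (1 + m)} a∈
      ... | a∈init , a∉ with Any.applyUpTo⁻ suc a∈init
      ...   | i , i<1+m , refl =
        subst (λ x → x ∸ suc i ∈ λs) (sym (trans 2n∸4≡8+2m 8+2m≡M))
              (missing⇒complement∈ (s≤s z≤n) (≤-trans i<1+m (m≤n+m (suc m) 2)) a∉)

    replacedCount : ℕ
    replacedCount = ∑[ i < 1 + m ] indicator (suc (6 + m + i) ∈? λs) 1

    length-initial : length initial ≡ replacedCount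
    length-initial = begin
      length initial
        ≡⟨ length-filter≡sum-indicator notPart? (applyUpTo suc (1 + m)) ⟩
      sum (map (λ a → indicator (notPart? a) 1) (applyUpTo suc (1 + m)))
        ≡⟨ cong sum (map-applyUpTo suc (λ a → indicator (notPart? a) 1) (1 + m)) ⟩
      sum (applyUpTo (λ i → indicator (notPart? (suc i)) 1) (1 + m))
        ≡⟨ sum-applyUpTo (λ i → indicator (notPart? (suc i)) 1) (1 + m) ⟩
      ∑[ i < 1 + m ] indicator (notPart? (suc i)) 1
        ≡⟨ ∑-reverse (1 + m) (λ i → indicator (notPart? (suc i)) 1) ⟩
      ∑[ i < 1 + m ] indicator (notPart? (suc (m ∸ i))) 1
        ≡⟨ ∑-cong (1 + m) (λ i i<1+m → indicator-cong (notPart? (suc (m ∸ i))) (suc (6 + m + i) ∈? λs) {1}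
                                          (replaced-if-missing i<1+m) (missing-if-replaced i<1+m)) ⟩
      replacedCount
        ∎
      where
      open ≡-Reasoning
      low≡ : ∀ {i} → i < 1 + m → low (2 + i) ≡ suc (m ∸ i)
      low≡ (s≤s i≤m) = +-∸-assoc 1 i≤m
      high≡ : ∀ i → high (2 + i) ≡ suc (6 + m + i)
      high≡ i = normalise m i
        where
        normalise : ∀ m i → suc (3 + m + 1 + (2 + i)) ≡ suc (6 + m + i)
        normalise = solve-∀
      replaced-if-missing : ∀ {i} → i < 1 + m → suc (m ∸ i) ∉ λs → suc (6 + m + i) ∈ λs
      replaced-if-missing {i} i<1+m low∉ =
        subst (_∈ λs) (high≡ i) (high∈ (s≤s (s≤s i<1+m)) (subst (_∉ λs) (sym (low≡ i<1+m)) low∉))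
      missing-if-replaced : ∀ {i} → i < 1 + m → suc (6 + m + i) ∈ λs → suc (m ∸ i) ∉ λs
      missing-if-replaced {i} i<1+m high∈ low∈ =
        high∉ (s≤s (s≤s i<1+m)) (subst (_∈ λs) (sym (low≡ i<1+m)) low∈) (subst (_∈ λs) (sym (high≡ i)) high∈)

    replacements≡1+replacedCount : replacements (6 + m) λs ≡ suc replacedCount
    replacements≡1+replacedCount = begin
      length (filter (6 + m <?_) λs)
        ≡⟨ length-filter≡sum-indicator (6 + m <?_) λs ⟩
      sum (map (λ x → indicator (6 + m <? x) 1) λs)
        ≡⟨ sum-map≡∑-indicator _ M λs increasing parts-within ⟩
      ∑ M counted
        ≡⟨ cong (λ l → ∑ l counted) (M≡ m) ⟩
      ∑ (6 + m + suc (suc m)) counted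
        ≡⟨ ∑-split (6 + m) (suc (suc m)) counted ⟩
      ∑ (6 + m) counted + ∑[ i < suc (suc m) ] counted (6 + m + i)
        ≡⟨ cong₂ _+_ (∑-zero (6 + m) counted below) (∑-snoc (suc m) (λ i → counted (6 + m + i))) ⟩
      0 + (∑[ i < suc m ] counted (6 + m + i) + counted (6 + m + suc m))
        ≡⟨ cong₂ _+_ (∑-cong (suc m) (λ i _ → above i)) (trans (above (suc m)) (indicator-yes (_ ∈? λs) last∈)) ⟩
      replacedCount + 1
        ≡⟨ +-comm replacedCount 1 ⟩
      suc replacedCount
        ∎
      where
      open ≡-Reasoning
      counted : ℕ → ℕ
      counted i = indicator (suc i ∈? λs) (indicator (6 + m <? suc i) 1)
      M≡ : ∀ m → suc (3 + m + 1 + (3 + m)) ≡ 6 + m + suc (suc m)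
      M≡ = solve-∀
      last∈ : suc (6 + m + suc m) ∈ λs
      last∈ = subst (_∈ λs) (normalise m) M∈L
        where
        normalise : ∀ m → suc (3 + m + 1 + (3 + m)) ≡ suc (6 + m + suc m)
        normalise = solve-∀
      below : ∀ i → i < 6 + m → counted i ≡ 0
      below i i<6+m = trans (cong (indicator (suc i ∈? λs)) (indicator-no (6 + m <? suc i) (<⇒≱ i<6+m ∘ ≤-pred)))
                            (indicator-zero (suc i ∈? λs))
      above : ∀ i → counted (6 + m + i) ≡ indicator (suc (6 + m + i) ∈? λs) 1
      above i = cong (indicator (suc (6 + m + i) ∈? λs))
                     (indicator-yes (6 + m <? suc (6 + m + i)) (s≤s (m≤m+n (6 + m) i)))

    removedStructure : RemovedStructure (6 + m) λs
    removedStructure with top-removed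
    ... | x , y , z , top≡ , triple =
      replacements≡ , initial , x , y , z , removed≡initial++xyz , initial-replaced , triple
      where
      removed≡initial++xyz : removed (6 + m) λs ≡ initial ++ x ∷ y ∷ z ∷ []
      removed≡initial++xyz = trans removed≡ (cong (initial ++_) top≡)
      replacements≡ : replacements (6 + m) λs ≡ length (removed (6 + m) λs) ∸ 2
      replacements≡ = begin
        replacements (6 + m) λs                      ≡⟨ replacements≡1+replacedCount ⟩
        suc replacedCount                            ≡⟨ cong suc (sym length-initial) ⟩
        suc (length initial)                         ≡⟨ +-comm 1 (length initial) ⟩
        length initial + 1                           ≡⟨ sym (+-∸-assoc (length initial) (s≤s (s≤s z≤n))) ⟩
        length initial + 3 ∸ 2                       ≡⟨ cong (_∸ 2) (sym (length-++ initial)) ⟩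
        length (initial ++ x ∷ y ∷ z ∷ []) ∸ 2       ≡⟨ cong (λ l → length l ∸ 2) (sym removed≡initial++xyz) ⟩
        length (removed (6 + m) λs) ∸ 2              ∎
        where open ≡-Reasoning

  even⇒≡piTilde : 2 ∣ 6 + m → λs ≡ piTilde (6 + m)
  even⇒≡piTilde 2∣n with shape
  ... | piTildeShape pairs        = piTildePairs⇒≡piTilde pairs
  ... | exclusiveShape 2∣n+1 _ = ⊥-elim (2∣n⇒2∤1+n 2∣n 2∣n+1)

  ≢piTilde⇒removedStructure : λs ≢ piTilde (6 + m) → RemovedStructure (6 + m) λs
  ≢piTilde⇒removedStructure λs≢ with shape
  ... | piTildeShape pairs          = ⊥-elim (λs≢ (piTildePairs⇒≡piTilde pairs))
  ... | exclusiveShape _ exclusive = Exclusive.removedStructure exclusive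

module _ (m : ℕ) where
  open PiTilde m

  piTilde-maximal : IsMaximalUnrefinable (T (6 + m)) (piTilde (6 + m))
  piTilde-maximal = (piTilde-isDistinctPartition , piTilde-unrefinable) , λ μ μ-unrefinable →
    ≤-trans (maxPart-unrefinable≤2n∸4 m μ μ-unrefinable) (≤-reflexive (sym maxPart-piTilde))

  maximal⇒maxPart≡2n∸4 : ∀ λs → IsMaximalUnrefinable (T (6 + m)) λs → maxPart λs ≡ 8 + (m + m)
  maximal⇒maxPart≡2n∸4 λs (λs-unrefinable , λs-maximal) =
    ≤-antisym (maxPart-unrefinable≤2n∸4 m λs λs-unrefinable)
              (subst (_≤ maxPart λs) maxPart-piTilde (λs-maximal (piTilde (6 + m)) (proj₁ piTilde-maximal)))

  maximal-even⇒≡piTilde : 2 ∣ 6 + m → ∀ λs → IsMaximalUnrefinable (T (6 + m)) λs → λs ≡ piTilde (6 + m)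
  maximal-even⇒≡piTilde 2∣n λs λs-maximal =
    Maximal.even⇒≡piTilde m λs (proj₁ λs-maximal) (maximal⇒maxPart≡2n∸4 λs λs-maximal) 2∣n

  maximal-≢piTilde⇒removedStructure : ∀ λs → IsMaximalUnrefinable (T (6 + m)) λs → λs ≢ piTilde (6 + m) →
                                      RemovedStructure (6 + m) λs
  maximal-≢piTilde⇒removedStructure λs λs-maximal =
    Maximal.≢piTilde⇒removedStructure m λs (proj₁ λs-maximal) (maximal⇒maxPart≡2n∸4 λs λs-maximal)

theorem4p1 : (n : ℕ) → 6 ≤ n →
    ((2 ∣ n) →
      IsMaximalUnrefinable (T n) (piTilde n) ×
      ((λs : List ℕ) → IsMaximalUnrefinable (T n) λs → λs ≡ piTilde n)) ×
    (¬ (2 ∣ n) →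
      IsMaximalUnrefinable (T n) (piTilde n) ×
      ((λs : List ℕ) → IsMaximalUnrefinable (T n) λs → λs ≢ piTilde n →
        replacements n λs ≡ length (removed n λs) ∸ 2 ×
        Σ (List ℕ) λ pre → Σ ℕ λ x → Σ ℕ λ y → Σ ℕ λ z →
          (removed n λs ≡ pre ++ (x ∷ y ∷ z ∷ [])) ×
          All (λ a → (2 * n ∸ 4 ∸ a) ∈ λs) pre ×
          ((x ≡ n ∸ 4 × y ≡ n ∸ 3 × z ≡ n ∸ 2) ⊎
           (x ≡ n ∸ 4 × y ≡ n ∸ 2 × z ≡ n ∸ 1) ⊎
           (x ≡ n ∸ 3 × y ≡ n ∸ 2 × z ≡ n) ⊎
           (x ≡ n ∸ 2 × y ≡ n ∸ 1 × z ≡ n))))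
theorem4p1 n 6≤n with m≤n⇒∃[o]m+o≡n 6≤n
... | m , refl =
  (λ 2∣n → piTilde-maximal m , maximal-even⇒≡piTilde m 2∣n) ,
  (λ _   → piTilde-maximal m , maximal-≢piTilde⇒removedStructure m)
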